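{- Let $\mathbf{ILX}$ be any logic extending $\mathbf{IL}$, $\Gamma,\Delta,\Lambda$ $\mathbf{ILX}$-MCSs, $S$ a $\Gamma$-full label and $T$ a $\Delta$-full label. If $\Gamma\prec_S\Delta\prec_T\Lambda$, then $S\subseteq T$.
   Context: Formulas: $\bot$, propositional variables, $\to$, $\Box$, binary $\rhd$; $\Diamond A:=\neg\Box\neg A$. $\mathbf{IL}$: classical tautologies, K, L: $\Box(\Box A\to A)\to\Box A$, J1: $\Box(A\to B)\to A\rhd B$, J2: $(A\rhd B)\wedge(B\rhd C)\to A\rhd C$, J3: $(A\rhd C)\wedge(B\rhd C)\to A\vee B\rhd C$, J4: $A\rhd B\to(\Diamond A\to\Diamond B)$, J5: $\Diamond A\rhd A$; rules modus ponens and necessitation. An $\mathbf{ILX}$-MCS is a maximal $\mathbf{ILX}$-consistent set. $\Gamma\prec_S\Delta$ iff for every formula $A$ and finite $S'\subseteq S$, $\neg A\rhd\bigvee_{\sigma\in S'}\neg\sigma\in\Gamma$ implies $A,\Box A\in\Delta$ (empty disjunction is $\bot$). For a MCS $\Theta$, a set $T$ is a $\Theta$-full label iff (i) $\neg A\rhd\bigvee_{\sigma\in T'}\neg\sigma\in\Theta$ for some finite $T'\subseteq T$ implies $A,\Box A\in T$; (ii) $T$ is closed under $\mathbf{ILX}$-consequence; (iii) $B\in T$ implies $\Box B\in T$. -}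

module Defs where

open import Data.Nat using (ℕ)
open import Data.Bool using (Bool; true; false; not; _∧_; _∨_)
open import Data.List using (List; []; _∷_; foldr; map)
open import Data.List.Relation.Unary.All using (All)
open import Data.Product using (_×_; ∃-syntax)
open import Relation.Binary.PropositionalEquality using (_≡_)
open import Relation.Nullary using (¬_)

infixr 6 _⇒_
infix 7 _▷_

data Fm : Set where
  ⊥' : Fm
  var : ℕ → Fm
  _⇒_ : Fm → Fm → Fm
  □ : Fm → Fm
  _▷_ : Fm → Fm → Fm

~ : Fm → Fm
~ A = A ⇒ ⊥'

_∨'_ : Fm → Fm → Fm
A ∨' B = ~ A ⇒ B

_∧'_ : Fm → Fm → Fm
A ∧' B = ~ (A ⇒ ~ B)

◇ : Fm → Fm
◇ A = ~ (□ (~ A))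

-- Classical tautologies: formulas true under every Boolean valuation that
-- treats variables, boxed formulas and ▷-formulas as atoms
-- (i.e. substitution instances of propositional tautologies).
eval : (Fm → Bool) → Fm → Bool
eval v ⊥' = false
eval v (var p) = v (var p)
eval v (A ⇒ B) = not (eval v A) ∨ eval v B
eval v (□ A) = v (□ A)
eval v (A ▷ B) = v (A ▷ B)

Taut : Fm → Set
Taut A = ∀ (v : Fm → Bool) → eval v A ≡ true

-- Theorems of ILX = IL extended with an arbitrary set X of extra axioms,
-- closed under modus ponens and necessitation.
data _⊢_ (X : Fm → Set) : Fm → Set where
  ax-X  : ∀ {A} → X A → X ⊢ A
  taut  : ∀ {A} → Taut A → X ⊢ A
  K     : ∀ {A B} → X ⊢ (□ (A ⇒ B) ⇒ (□ A ⇒ □ B))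
  L     : ∀ {A} → X ⊢ (□ (□ A ⇒ A) ⇒ □ A)
  J1    : ∀ {A B} → X ⊢ (□ (A ⇒ B) ⇒ (A ▷ B))
  J2    : ∀ {A B C} → X ⊢ (((A ▷ B) ∧' (B ▷ C)) ⇒ (A ▷ C))
  J3    : ∀ {A B C} → X ⊢ (((A ▷ C) ∧' (B ▷ C)) ⇒ ((A ∨' B) ▷ C))
  J4    : ∀ {A B} → X ⊢ ((A ▷ B) ⇒ (◇ A ⇒ ◇ B))
  J5    : ∀ {A} → X ⊢ (◇ A ▷ A)
  mp    : ∀ {A B} → X ⊢ (A ⇒ B) → X ⊢ A → X ⊢ B
  nec   : ∀ {A} → X ⊢ A → X ⊢ □ A

FmSet : Set₁
FmSet = Fm → Set

_⊆_ : FmSet → FmSet → Set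
S ⊆ T = ∀ {A} → S A → T A

_∪｛_｝ : FmSet → Fm → FmSet
(Γ ∪｛ A ｝) B = Γ B Data.Sum.⊎ (B ≡ A)
  where import Data.Sum

⋀ : List Fm → Fm
⋀ = foldr _∧'_ (~ ⊥')

⋁ : List Fm → Fm
⋁ = foldr _∨'_ ⊥'

_,_⊢_ : (Fm → Set) → FmSet → Fm → Set
X , Γ ⊢ A = ∃[ l ] (All Γ l × (X ⊢ (⋀ l ⇒ A)))

Consistent : (Fm → Set) → FmSet → Set
Consistent X Γ = ¬ (X , Γ ⊢ ⊥')

MCS : (Fm → Set) → FmSet → Set
MCS X Γ = Consistent X Γ × (∀ A → Consistent X (Γ ∪｛ A ｝) → Γ A)

crit : Fm → List Fm → Fm
crit A S' = ~ A ▷ ⋁ (map ~ S')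

_≺[_]_ : FmSet → FmSet → FmSet → Set
Γ ≺[ S ] Δ = ∀ A (S' : List Fm) → All S S' → Γ (crit A S') → Δ A × Δ (□ A)

FullLabel : (Fm → Set) → FmSet → FmSet → Set
FullLabel X Θ T =
  (∀ A (T' : List Fm) → All T T' → Θ (crit A T') → T A × T (□ A))
  × (∀ A → X , T ⊢ A → T A)
  × (∀ B → T B → T (□ B))

module Submission where

-- Lemma 4.14: if Γ ≺_S Δ ≺_T Λ, with S a Γ-full label and T a Δ-full label,
-- then S ⊆ T.  Only the first step Γ ≺_S Δ and the fullness of T matter.
--
-- Idea.  For σ ∈ S the J5 instance  ◇¬¬¬σ ▷ ¬¬¬σ  lies in Γ, and it has the
-- shape  ¬A ▷ ⋁{¬σ}  with  A = □¬¬¬¬σ.  Hence Γ ≺_S Δ puts □¬¬¬¬σ, and so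
-- □σ, into Δ.  Conversely, if □σ ∈ Δ then by J1 the formula  ¬σ ▷ ⊥  (the
-- empty-disjunction instance of the label condition) lies in Δ, so σ ∈ T by
-- clause (i) of "T is a Δ-full label".

open import Defs
open import Data.Bool using (Bool; true; false; not; _∧_; _∨_; T)
open import Data.Bool.Properties using (T-≡; T-∧)
open import Data.Fin using (Fin; zero; suc)
open import Data.List using (List; []; _∷_)
open import Data.List.Relation.Unary.All using (All; []; _∷_)
open import Data.Nat using (ℕ; zero; suc; _+_)
open import Data.Product using (∃; _×_; _,_; proj₁; proj₂)
open import Data.Sum using (inj₁; inj₂)
open import Data.Vec using (Vec; []; _∷_; lookup; map)
open import Data.Vec.Properties using (lookup-map)
open import Function using (_∘_)
open import Function.Bundles using (Equivalence)
open import Relation.Binary.PropositionalEquality using (_≡_; refl; sym; trans; cong₂)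

data Schema (n : ℕ) : Set where
  ⊥ˢ    : Schema n
  atom  : Fin n → Schema n
  _⇒ˢ_  : Schema n → Schema n → Schema n

infixr 6 _⇒ˢ_
infixr 7 _∧ˢ_

~ˢ : ∀ {n} → Schema n → Schema n
~ˢ φ = φ ⇒ˢ ⊥ˢ

_∧ˢ_ : ∀ {n} → Schema n → Schema n → Schema n
φ ∧ˢ ψ = ~ˢ (φ ⇒ˢ ~ˢ ψ)

-- Substituting formulas for the metavariables; the derived connectives
-- ~ˢ and ∧ˢ become ~ and ∧' definitionally.
instantiate : ∀ {n} → Schema n → Vec Fm n → Fm
instantiate ⊥ˢ       ρ = ⊥'
instantiate (atom i) ρ = lookup ρ i
instantiate (φ ⇒ˢ ψ) ρ = instantiate φ ρ ⇒ instantiate ψ ρ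

value : ∀ {n} → Schema n → Vec Bool n → Bool
value ⊥ˢ       β = false
value (atom i) β = lookup β i
value (φ ⇒ˢ ψ) β = not (value φ β) ∨ value ψ β

eval-instantiate : ∀ {n} (v : Fm → Bool) (φ : Schema n) (ρ : Vec Fm n)
  → eval v (instantiate φ ρ) ≡ value φ (map (eval v) ρ)
eval-instantiate v ⊥ˢ       ρ = refl
eval-instantiate v (atom i) ρ = sym (lookup-map i (eval v) ρ)
eval-instantiate v (φ ⇒ˢ ψ) ρ =
  cong₂ (λ a b → not a ∨ b) (eval-instantiate v φ ρ) (eval-instantiate v ψ ρ)

forAll : (n : ℕ) → (Vec Bool n → Bool) → Bool
forAll zero    f = f []
forAll (suc n) f = forAll n (f ∘ (true ∷_)) ∧ forAll n (f ∘ (false ∷_))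

forAll-sound : ∀ n (f : Vec Bool n → Bool) → T (forAll n f) → ∀ β → T (f β)
forAll-sound zero    f ok [] = ok
forAll-sound (suc n) f ok (true ∷ β)  =
  forAll-sound n (f ∘ (true ∷_)) (proj₁ (Equivalence.to T-∧ ok)) β
forAll-sound (suc n) f ok (false ∷ β) =
  forAll-sound n (f ∘ (false ∷_)) (proj₂ (Equivalence.to T-∧ ok)) β

-- Every instance of a valid schema is a theorem.  The validity proof is an
-- implicit argument of type T true, found automatically for valid schemas.
tautology : ∀ {X n} (φ : Schema n) {valid : T (forAll n (value φ))} (ρ : Vec Fm n)
  → X ⊢ instantiate φ ρ
tautology {n = n} φ {valid} ρ = taut λ v →
  trans (eval-instantiate v φ ρ)
        (Equivalence.to T-≡ (forAll-sound n (value φ) valid (map (eval v) ρ)))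

-- Metavariables for writing schemas; the number of metavariables of a
-- schema is fixed by the length of the substitution it is applied to.
P : ∀ {n} → Schema (1 + n)
P = atom zero
Q : ∀ {n} → Schema (2 + n)
Q = atom (suc zero)
R : ∀ {n} → Schema (3 + n)
R = atom (suc (suc zero))
U : ∀ {n} → Schema (4 + n)
U = atom (suc (suc (suc zero)))

module _ {X : Fm → Set} where

  -- Derivability from finitely many members of Δ, written Δ ⊩ A to avoid a
  -- clash between the mixfix X , Δ ⊢ A and the pairing constructor.
  _⊩_ : FmSet → Fm → Set
  Δ ⊩ A = _,_⊢_ X Δ A

  infix 4 _⊩_

  mp₂ : ∀ {A B C} → X ⊢ (A ⇒ B ⇒ C) → X ⊢ A → X ⊢ B → X ⊢ C
  mp₂ t a b = mp (mp t a) b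

  ⇒-trans : ∀ {A B C} → X ⊢ (A ⇒ B) → X ⊢ (B ⇒ C) → X ⊢ (A ⇒ C)
  ⇒-trans {A} {B} {C} =
    mp₂ (tautology ((P ⇒ˢ Q) ⇒ˢ (Q ⇒ˢ R) ⇒ˢ P ⇒ˢ R) (A ∷ B ∷ C ∷ []))

  □-mono : ∀ {A B} → X ⊢ (A ⇒ B) → X ⊢ (□ A ⇒ □ B)
  □-mono p = mp K (nec p)

  discharge : ∀ (Δ : FmSet) B l → All (Δ ∪｛ B ｝) l
    → ∃ λ l' → All Δ l' × X ⊢ (⋀ l' ⇒ B ⇒ ⋀ l)
  discharge Δ B [] [] = [] , [] , tautology (P ⇒ˢ Q ⇒ˢ P) (⋀ [] ∷ B ∷ [])
  discharge Δ B (x ∷ l) (inj₁ x∈Δ ∷ l⊆) with discharge Δ B l l⊆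
  ... | l' , l'⊆Δ , p = x ∷ l' , x∈Δ ∷ l'⊆Δ ,
    mp (tautology ((Q ⇒ˢ R ⇒ˢ P) ⇒ˢ (U ∧ˢ Q) ⇒ˢ R ⇒ˢ U ∧ˢ P)
                  (⋀ l ∷ ⋀ l' ∷ B ∷ x ∷ [])) p
  discharge Δ B (.B ∷ l) (inj₂ refl ∷ l⊆) with discharge Δ B l l⊆
  ... | l' , l'⊆Δ , p = l' , l'⊆Δ ,
    mp (tautology ((Q ⇒ˢ R ⇒ˢ P) ⇒ˢ Q ⇒ˢ R ⇒ˢ R ∧ˢ P) (⋀ l ∷ ⋀ l' ∷ B ∷ [])) p

  deduction : ∀ (Δ : FmSet) B → (Δ ∪｛ B ｝) ⊩ ⊥' → Δ ⊩ ~ B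
  deduction Δ B (l , l⊆ , l⊢⊥) with discharge Δ B l l⊆
  ... | l' , l'⊆Δ , p = l' , l'⊆Δ ,
    mp₂ (tautology ((P ⇒ˢ ⊥ˢ) ⇒ˢ (Q ⇒ˢ R ⇒ˢ P) ⇒ˢ Q ⇒ˢ ~ˢ R) (⋀ l ∷ ⋀ l' ∷ B ∷ []))
        l⊢⊥ p

  mcs-by-refutation : ∀ {Δ} B → MCS X Δ → (Δ ⊩ ~ B → Δ ⊩ ⊥') → Δ B
  mcs-by-refutation {Δ} B (consistent , maximal) refute =
    maximal B λ inconsistent → consistent (refute (deduction Δ B inconsistent))

  mcs-theorem : ∀ {Δ B} → MCS X Δ → X ⊢ B → Δ B
  mcs-theorem {B = B} M ⊢B = mcs-by-refutation B M λ { (l , l⊆ , l⊢¬B) →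
    l , l⊆ , mp₂ (tautology ((P ⇒ˢ ~ˢ Q) ⇒ˢ Q ⇒ˢ ~ˢ P) (⋀ l ∷ B ∷ [])) l⊢¬B ⊢B }

  mcs-mp : ∀ {Δ C B} → MCS X Δ → Δ C → X ⊢ (C ⇒ B) → Δ B
  mcs-mp {C = C} {B} M C∈Δ ⊢C⇒B = mcs-by-refutation B M λ { (l , l⊆ , l⊢¬B) →
    C ∷ l , C∈Δ ∷ l⊆ ,
    mp₂ (tautology ((P ⇒ˢ Q) ⇒ˢ (R ⇒ˢ ~ˢ Q) ⇒ˢ ~ˢ (P ∧ˢ R)) (C ∷ B ∷ ⋀ l ∷ []))
        ⊢C⇒B l⊢¬B }

  -- First half: every σ ∈ S is boxed in each ≺_S-successor of an MCS.
  -- The J5 instance ◇¬¬¬σ ▷ ¬¬¬σ is literally crit (□¬¬¬¬σ) [σ].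
  label-boxed-in-successor : ∀ {Γ Δ S σ} → MCS X Γ → MCS X Δ
    → Γ ≺[ S ] Δ → S σ → Δ (□ σ)
  label-boxed-in-successor {Δ = Δ} {σ = σ} MΓ MΔ Γ≺Δ σ∈S = mcs-mp MΔ Δ∋□¬¬¬¬σ
    (□-mono (tautology (~ˢ (~ˢ (~ˢ (~ˢ P))) ⇒ˢ P) (σ ∷ [])))
    where
    Δ∋□¬¬¬¬σ : Δ (□ (~ (~ (~ (~ σ)))))
    Δ∋□¬¬¬¬σ = proj₁ (Γ≺Δ _ (σ ∷ []) (σ∈S ∷ []) (mcs-theorem MΓ J5))

  -- Second half: a Δ-full label contains every σ with □σ ∈ Δ, since by J1
  -- Δ contains ¬σ ▷ ⊥ = crit σ [].
  full-label-contains-boxed : ∀ {Δ T σ} → MCS X Δ → FullLabel X Δ T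
    → Δ (□ σ) → T σ
  full-label-contains-boxed {σ = σ} MΔ (label-crit , _ , _) Δ∋□σ =
    proj₁ (label-crit σ [] [] (mcs-mp MΔ Δ∋□σ (⇒-trans □σ⇒□¬¬σ J1)))
    where
    □σ⇒□¬¬σ : X ⊢ (□ σ ⇒ □ (~ (~ σ)))
    □σ⇒□¬¬σ = □-mono (tautology (P ⇒ˢ ~ˢ (~ˢ P)) (σ ∷ []))

lemma4p14 : (X : Fm → Set) (Γ Δ Λ S T : FmSet)
    → MCS X Γ → MCS X Δ → MCS X Λ
    → FullLabel X Γ S → FullLabel X Δ T
    → Γ ≺[ S ] Δ → Δ ≺[ T ] Λ
    → S ⊆ T
lemma4p14 X Γ Δ Λ S T MΓ MΔ _ _ FT Γ≺Δ _ σ∈S =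
  full-label-contains-boxed MΔ FT (label-boxed-in-successor MΓ MΔ Γ≺Δ σ∈S)
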